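{- In the setting below, $h(\bot)=\varnothing^{\rhd\lhd}$.
   Context: Let $\mathcal K=(K;\preceq,\cdot,\backslash,/,\wedge,\vee,\top,\bot,\mathbf 1)$ where $(K;\preceq,\wedge,\vee,\top,\bot)$ is a bounded lattice, $(K;\cdot,\mathbf 1)$ a monoid, $b\preceq a\backslash c\iff a\cdot b\preceq c\iff a\preceq c/b$, and $a^+=\sup\{a^n\mid n\ge1\}$ exists for all $a$ (an infinitary action lattice). Let $\overline\Sigma=\{\overline a\mid a\in K\}$, $\underline\Sigma=\{\underline b\mid b\in K\}$ be disjoint copies of $K$, $\Sigma=\overline\Sigma\cup\underline\Sigma$. For $x\in\Sigma^*$, $x^\bullet\in K$ is the product (in order) of the elements $a$ over all letters $\overline a$ of $x$ from $\overline\Sigma$, ignoring letters from $\underline\Sigma$ (empty product $=\mathbf 1$). Let $L=\{x\underline b\mid x\in\Sigma^*,b\in K,x^\bullet\preceq b\}\cup\{z\in\Sigma^*\mid z^\bullet=\bot\}$ and $h(b)=\{x\in\Sigma^*\mid x\underline b\in L\}$. For $M\subseteq\Sigma^*$, $M^{\rhd}=\{(x,y)\in\Sigma^*\times\Sigma^*\mid\forall w\in M\;xwy\in L\}$; for $C\subseteq\Sigma^*\times\Sigma^*$, $C^{\lhd}=\{v\in\Sigma^*\mid\forall(x,y)\in C\;xvy\in L\}$. -}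

module Defs where

open import Level using (Level; _⊔_; suc)
open import Data.Nat using (ℕ; zero) renaming (suc to sucℕ)
open import Data.List using (List; []; _∷_; _++_; [_])
open import Data.Product using (Σ; _×_; _,_)
open import Data.Sum using (_⊎_)
open import Relation.Binary.PropositionalEquality using (_≡_)
open import Relation.Binary.Structures using (IsPartialOrder)

power : ∀ {c} {K : Set c} → (K → K → K) → K → K → ℕ → K
power _·_ e a zero     = e
power _·_ e a (sucℕ n) = a · power _·_ e a n

record InfinitaryActionLattice (c ℓ : Level) : Set (suc (c ⊔ ℓ)) where
  infix  4 _⪯_
  infixl 7 _·_
  field
    K      : Set c
    _⪯_    : K → K → Set ℓ
    _·_    : K → K → K
    _\\_   : K → K → K
    _//_   : K → K → K
    _∧_    : K → K → K
    _∨_    : K → K → K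
    ⊤ ⊥ 𝟏  : K
    _⁺     : K → K
    isPartialOrder : IsPartialOrder _≡_ _⪯_
    ∧-lb₁  : ∀ a b → a ∧ b ⪯ a
    ∧-lb₂  : ∀ a b → a ∧ b ⪯ b
    ∧-glb  : ∀ a b c → c ⪯ a → c ⪯ b → c ⪯ a ∧ b
    ∨-ub₁  : ∀ a b → a ⪯ a ∨ b
    ∨-ub₂  : ∀ a b → b ⪯ a ∨ b
    ∨-lub  : ∀ a b c → a ⪯ c → b ⪯ c → a ∨ b ⪯ c
    ⊤-max  : ∀ a → a ⪯ ⊤
    ⊥-min  : ∀ a → ⊥ ⪯ a
    ·-assoc : ∀ a b c → (a · b) · c ≡ a · (b · c)
    ·-idˡ   : ∀ a → 𝟏 · a ≡ a
    ·-idʳ   : ∀ a → a · 𝟏 ≡ a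
    resˡ₁ : ∀ a b c → b ⪯ a \\ c → a · b ⪯ c
    resˡ₂ : ∀ a b c → a · b ⪯ c → b ⪯ a \\ c
    resʳ₁ : ∀ a b c → a ⪯ c // b → a · b ⪯ c
    resʳ₂ : ∀ a b c → a · b ⪯ c → a ⪯ c // b
    ⁺-ub  : ∀ a n → power _·_ 𝟏 a (sucℕ n) ⪯ a ⁺
    ⁺-lub : ∀ a c → (∀ n → power _·_ 𝟏 a (sucℕ n) ⪯ c) → a ⁺ ⪯ c

module Construction {c ℓ : Level} (𝒦 : InfinitaryActionLattice c ℓ) where
  open InfinitaryActionLattice 𝒦

  -- Σ = overline-copy ∪ underline-copy of K
  data Letter : Set c where
    over  : K → Letter
    under : K → Letter

  Word : Set c
  Word = List Letter

  _• : Word → K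
  [] •              = 𝟏
  (over a  ∷ x) •   = a · (x •)
  (under b ∷ x) •   = x •

  WordSet : Set (suc (c ⊔ ℓ))
  WordSet = Word → Set (c ⊔ ℓ)

  PairSet : Set (suc (c ⊔ ℓ))
  PairSet = Word → Word → Set (c ⊔ ℓ)

  𝕃 : WordSet
  𝕃 w = Σ Word (λ x → Σ K (λ b → (w ≡ x ++ [ under b ]) × (x • ⪯ b)))
        ⊎ (w • ≡ ⊥)

  h : K → WordSet
  h b x = 𝕃 (x ++ [ under b ])

  _▷ : WordSet → PairSet
  (M ▷) x y = ∀ w → M w → 𝕃 (x ++ w ++ y)

  _◁ : PairSet → WordSet
  (C ◁) v = ∀ x y → C x y → 𝕃 (x ++ v ++ y)

  ∅ : WordSet
  ∅ _ = Lift⊥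
    where open import Data.Empty.Polymorphic using () renaming (⊥ to Lift⊥)

  _≐_ : WordSet → WordSet → Set (c ⊔ ℓ)
  A ≐ B = (∀ w → A w → B w) × (∀ w → B w → A w)

-- A word v lies in h(⊥) exactly when v• = ⊥. Residuation makes ⊥ absorbing
-- (a · ⊥ ⪯ ⊥ because ⊥ ⪯ a \ ⊥), so every word with v as a factor has
-- product ⊥ and lies in L; hence v ∈ C◁ for every C. Conversely ∅▷ contains
-- every pair, in particular (ε , ⊥̲), and that pair alone forces v⊥̲ ∈ L.
module Submission where

open import Defs
open import Data.List using ([]; _∷_; _++_; [_]; _∷ʳ_)
open import Data.List.Properties using (∷ʳ-injective)
open import Data.Product using (_,_)
open import Data.Sum using (inj₁; inj₂)
open import Relation.Binary.PropositionalEquality using (_≡_; refl; sym; trans; cong; module ≡-Reasoning)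
open import Relation.Binary.Structures using (IsPartialOrder)

module _ {c ℓ} (𝒦 : InfinitaryActionLattice c ℓ) where
  open InfinitaryActionLattice 𝒦
  open Construction 𝒦

  ⪯-antisym : ∀ {a b} → a ⪯ b → b ⪯ a → a ≡ b
  ⪯-antisym = IsPartialOrder.antisym isPartialOrder

  ·-zeroˡ : ∀ a → ⊥ · a ≡ ⊥
  ·-zeroˡ a = ⪯-antisym (resʳ₁ ⊥ a ⊥ (⊥-min _)) (⊥-min _)

  ·-zeroʳ : ∀ a → a · ⊥ ≡ ⊥
  ·-zeroʳ a = ⪯-antisym (resˡ₁ a ⊥ ⊥ (⊥-min _)) (⊥-min _)

  •-++ : ∀ x y → (x ++ y) • ≡ x • · y •
  •-++ []            y = sym (·-idˡ _)
  •-++ (over a ∷ x)  y = trans (cong (a ·_) (•-++ x y)) (sym (·-assoc _ _ _))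
  •-++ (under b ∷ x) y = •-++ x y

  •-∷ʳ-under : ∀ v b → (v ∷ʳ under b) • ≡ v •
  •-∷ʳ-under v b = trans (•-++ v [ under b ]) (·-idʳ _)

  •≡⊥-infix : ∀ x v y → v • ≡ ⊥ → (x ++ v ++ y) • ≡ ⊥
  •≡⊥-infix x v y v•≡⊥ = begin
    (x ++ v ++ y) •    ≡⟨ •-++ x (v ++ y) ⟩
    x • · (v ++ y) •   ≡⟨ cong (x • ·_) (•-++ v y) ⟩
    x • · (v • · y •)  ≡⟨ cong (λ t → x • · (t · y •)) v•≡⊥ ⟩
    x • · (⊥ · y •)    ≡⟨ cong (x • ·_) (·-zeroˡ _) ⟩
    x • · ⊥            ≡⟨ ·-zeroʳ _ ⟩
    ⊥                  ∎
    where open ≡-Reasoning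

  h⊥⇒•≡⊥ : ∀ v → h ⊥ v → v • ≡ ⊥
  h⊥⇒•≡⊥ v (inj₁ (x , b , eq , x•⪯b)) with ∷ʳ-injective v x eq
  ... | refl , refl = ⪯-antisym x•⪯b (⊥-min _)
  h⊥⇒•≡⊥ v (inj₂ eq) = trans (sym (•-∷ʳ-under v ⊥)) eq

  •≡⊥⇒∈◁ : ∀ (C : PairSet) v → v • ≡ ⊥ → (C ◁) v
  •≡⊥⇒∈◁ C v v•≡⊥ x y _ = inj₂ (•≡⊥-infix x v y v•≡⊥)

  ∅▷-full : ∀ x y → (∅ ▷) x y
  ∅▷-full x y w ()

lemma10 : ∀ {c ℓ} (𝒦 : InfinitaryActionLattice c ℓ) →
            let open InfinitaryActionLattice 𝒦
                open Construction 𝒦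
            in h ⊥ ≐ ((∅ ▷) ◁)
lemma10 𝒦 = h⊥⊆∅▷◁ , ∅▷◁⊆h⊥
  where
  open InfinitaryActionLattice 𝒦
  open Construction 𝒦

  h⊥⊆∅▷◁ : ∀ v → h ⊥ v → ((∅ ▷) ◁) v
  h⊥⊆∅▷◁ v v∈h⊥ = •≡⊥⇒∈◁ 𝒦 (∅ ▷) v (h⊥⇒•≡⊥ 𝒦 v v∈h⊥)

  ∅▷◁⊆h⊥ : ∀ v → ((∅ ▷) ◁) v → h ⊥ v
  ∅▷◁⊆h⊥ v v∈∅▷◁ = v∈∅▷◁ [] [ under ⊥ ] (∅▷-full 𝒦 [] [ under ⊥ ])
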